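{- Let $H$ be a subcubic graph and let $G$ be a graph that contains $H$ as a minor. Then every minimal minor model $\{X_v\}_{v\in V(H)}$ of $H$ in $G$ is such that for each $v \in V(H)$, the induced subgraph $G[X_v]$ has clique number at most $3$.
   Context: All graphs are finite, simple and undirected. A graph is subcubic if every vertex has degree at most $3$. A minor model of a graph $H$ in a graph $G$ is a collection $\{X_v\}_{v\in V(H)}$ of pairwise disjoint sets $X_v\subseteq V(G)$ (branch sets) such that each $G[X_v]$ is connected and, for every edge $uv\in E(H)$, there is an edge of $G$ between $X_u$ and $X_v$. A minor model is minimal if deleting any vertex from any of its branch sets yields a collection that is not a minor model of $H$ in $G$. The clique number $\omega$ is the size of a largest clique. -}

module Defs where

open import Data.Nat using (ℕ; _≤_)
open import Data.Fin using (Fin; _≟_)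
open import Data.Fin.Subset using (Subset; _∈_; _⊆_; ∣_∣; Nonempty; _─_; ⁅_⁆)
open import Data.Vec using (tabulate)
open import Data.Empty using (⊥)
open import Data.Product using (Σ; _×_)
open import Relation.Nullary using (¬_; Dec; does; yes; no)
open import Relation.Binary.PropositionalEquality using (_≡_)

record Graph : Set₁ where
  field
    n      : ℕ
    Adj    : Fin n → Fin n → Set
    adj?   : ∀ u v → Dec (Adj u v)
    sym    : ∀ {u v} → Adj u v → Adj v u
    irrefl : ∀ {u} → ¬ Adj u u
open Graph public

nbhd : (G : Graph) → Fin (n G) → Subset (n G)
nbhd G v = tabulate (λ u → does (adj? G v u))

degree : (G : Graph) → Fin (n G) → ℕ
degree G v = ∣ nbhd G v ∣

Subcubic : Graph → Set
Subcubic G = ∀ v → degree G v ≤ 3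

data WalkIn (G : Graph) (X : Subset (n G)) : Fin (n G) → Fin (n G) → Set where
  here : ∀ {x} → x ∈ X → WalkIn G X x x
  step : ∀ {x y z} → x ∈ X → Adj G x y → WalkIn G X y z → WalkIn G X x z

-- G[X] is connected (connected graphs are non-empty).
ConnectedIn : (G : Graph) → Subset (n G) → Set
ConnectedIn G X = Nonempty X × (∀ x y → x ∈ X → y ∈ X → WalkIn G X x y)

record IsMinorModel (H G : Graph) (X : Fin (n H) → Subset (n G)) : Set where
  field
    disjoint  : ∀ u w → ¬ (u ≡ w) → ∀ x → x ∈ X u → x ∈ X w → ⊥
    connected : ∀ v → ConnectedIn G (X v)
    edges     : ∀ u w → Adj H u w →
                Σ (Fin (n G)) (λ x → Σ (Fin (n G)) (λ y → x ∈ X u × y ∈ X w × Adj G x y))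

deleteFrom : ∀ {k m} → (Fin k → Subset m) → Fin k → Fin m → (Fin k → Subset m)
deleteFrom X v x w with w ≟ v
... | yes _ = X w ─ ⁅ x ⁆
... | no _  = X w

IsMinimalMinorModel : (H G : Graph) → (Fin (n H) → Subset (n G)) → Set
IsMinimalMinorModel H G X =
  IsMinorModel H G X × (∀ v x → x ∈ X v → ¬ IsMinorModel H G (deleteFrom X v x))

IsCliqueIn : (G : Graph) → Subset (n G) → Subset (n G) → Set
IsCliqueIn G X K = K ⊆ X × (∀ x y → x ∈ K → y ∈ K → ¬ (x ≡ y) → Adj G x y)

CliqueNumberAtMost : (G : Graph) → Subset (n G) → ℕ → Set
CliqueNumberAtMost G X k = ∀ K → IsCliqueIn G X K → ∣ K ∣ ≤ k

-- If G[X v] contained a clique K with at least two vertices and more vertices than v has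
-- neighbours, pick for every neighbour u of v a terminal in X v adjacent to X u. Walks from the
-- terminals into K first enter K at fewer than ∣ K ∣ vertices, so some k ∈ K is no entry point;
-- then every terminal lies in the component C of G[X v - k] containing K - k. Since X v is
-- connected and C ⊂ X v, some z ∉ C is not a cut vertex of G[X v], and deleting z from X v
-- keeps a minor model, against minimality. Hence ω(G[X v]) ≤ max(1, deg v) ≤ 3.
module Submission where

open import Defs renaming (sym to Adj-sym)
open import Data.Nat using (ℕ; suc; _≤_; _<_; z≤n; s≤s; s≤s⁻¹)
open import Data.Nat.Properties
  using (_≤?_; ≰⇒>; ≤-reflexive; ≤-trans; n≤1+n; n≮0; ≤-<-trans; <-≤-trans)
open import Data.Fin using (Fin; zero; suc; _≟_)
open import Data.Fin.Properties using (any?)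
open import Data.Fin.Subset
  using (Subset; _∈_; _∉_; _⊆_; _⊂_; _⊃_; ∣_∣; Nonempty; _∪_; _-_; ⁅_⁆; inside; outside)
open import Data.Fin.Subset.Properties
  using ( _∈?_; x∈⁅x⁆; x∈⁅y⁆⇒x≡y; p⊆p∪q; q⊆p∪q; x∈p∪q⁻; x∈p∧x≢y⇒x∈p-y; p─q⊆p
        ; p─⊥≡p; ⊆-trans; nonempty?; Empty-unique; ∣⊥∣≡0)
open import Data.Fin.Subset.Induction using (Acc; acc; ⊃-wellFounded)
open import Data.Vec using (_∷_; []; here; there)
open import Data.Vec.Properties using (lookup∘tabulate; lookup⇒[]=; []=⇒lookup)
open import Data.Product using (∃; ∃₂; _×_; _,_; proj₁; proj₂)
open import Data.Sum using (inj₁; inj₂; [_,_]′)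
open import Function using (id; _∘_)
open import Relation.Nullary using (yes; no; contradiction)
open import Relation.Nullary.Decidable using (_×-dec_; ¬?; dec-true; decidable-stable)
open import Relation.Binary.PropositionalEquality
  using (_≢_; refl; sym; trans; subst; cong; ≢-sym)

private variable
  m k : ℕ

p-x⊆p : ∀ (p : Subset m) x → p - x ⊆ p
p-x⊆p p x = p─q⊆p p ⁅ x ⁆

x∈p-y⇒x≢y : ∀ {p : Subset m} {x y} → x ∈ p - y → x ≢ y
x∈p-y⇒x≢y {p = _ ∷ _}  {zero}  {zero}  ()
x∈p-y⇒x≢y {p = _ ∷ p} {suc x} {suc y} (there x∈p-y) refl = x∈p-y⇒x≢y {p = p} x∈p-y refl

p⊂p∪⁅x⁆ : ∀ {p : Subset m} {x} → x ∉ p → p ⊂ p ∪ ⁅ x ⁆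
p⊂p∪⁅x⁆ {p = p} {x} x∉p = p⊆p∪q ⁅ x ⁆ , x , q⊆p∪q p ⁅ x ⁆ (x∈⁅x⁆ x) , x∉p

p∪⁅x⁆⊆q : ∀ {p q : Subset m} {x} → p ⊆ q → x ∈ q → p ∪ ⁅ x ⁆ ⊆ q
p∪⁅x⁆⊆q {p = p} {x = x} p⊆q x∈q y∈p∪x with x∈p∪q⁻ p ⁅ x ⁆ y∈p∪x
... | inj₁ y∈p = p⊆q y∈p
... | inj₂ y∈x with refl ← x∈⁅y⁆⇒x≡y x y∈x = x∈q

∣p∣≤suc∣p-x∣ : ∀ (p : Subset m) x → ∣ p ∣ ≤ suc ∣ p - x ∣
∣p∣≤suc∣p-x∣ (inside ∷ p)  zero    = ≤-reflexive (cong (suc ∘ ∣_∣) (sym (p─⊥≡p p)))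
∣p∣≤suc∣p-x∣ (outside ∷ p) zero    =
  ≤-trans (n≤1+n ∣ p ∣) (≤-reflexive (cong (suc ∘ ∣_∣) (sym (p─⊥≡p p))))
∣p∣≤suc∣p-x∣ (inside ∷ p)  (suc x) = s≤s (∣p∣≤suc∣p-x∣ p x)
∣p∣≤suc∣p-x∣ (outside ∷ p) (suc x) = ∣p∣≤suc∣p-x∣ p x

0<∣p∣⇒Nonempty : ∀ {p : Subset m} → 0 < ∣ p ∣ → Nonempty p
0<∣p∣⇒Nonempty {m} {p} 0<∣p∣ with nonempty? p
... | yes ne = ne
... | no empty =
  contradiction (subst (0 <_) (∣⊥∣≡0 m) (subst (λ q → 0 < ∣ q ∣) (Empty-unique empty) 0<∣p∣)) n≮0

∣p∣<∣q∣⇒∃-missed : ∀ {p : Subset m} {q : Subset k} → ∣ p ∣ < ∣ q ∣ → (f : ∀ {x} → x ∈ p → Fin k) →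
                    ∃ λ y → y ∈ q × ∀ {x} (x∈p : x ∈ p) → f x∈p ≢ y
∣p∣<∣q∣⇒∃-missed {p = []} ∣p∣<∣q∣ f with y , y∈q ← 0<∣p∣⇒Nonempty ∣p∣<∣q∣ = y , y∈q , λ ()
∣p∣<∣q∣⇒∃-missed {p = outside ∷ p} ∣p∣<∣q∣ f
  with y , y∈q , missed ← ∣p∣<∣q∣⇒∃-missed {p = p} ∣p∣<∣q∣ (f ∘ there)
  = y , y∈q , λ { (there x∈p) → missed x∈p }
∣p∣<∣q∣⇒∃-missed {p = inside ∷ p} {q = q} ∣p∣<∣q∣ f
  with y , y∈q-f₀ , missed ←
       ∣p∣<∣q∣⇒∃-missed {p = p} (s≤s⁻¹ (<-≤-trans ∣p∣<∣q∣ (∣p∣≤suc∣p-x∣ q (f here)))) (f ∘ there)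
  = y , p-x⊆p q (f here) y∈q-f₀ , λ { here → ≢-sym (x∈p-y⇒x≢y y∈q-f₀) ; (there x∈p) → missed x∈p }

module _ (G : Graph) where

  private variable
    A R S X Y : Subset (n G)
    r w x y : Fin (n G)

  walk-source : WalkIn G X x y → x ∈ X
  walk-source (here x∈X)     = x∈X
  walk-source (step x∈X _ _) = x∈X

  walk-mono : X ⊆ Y → WalkIn G X x y → WalkIn G Y x y
  walk-mono X⊆Y (here x∈X)          = here (X⊆Y x∈X)
  walk-mono X⊆Y (step x∈X x~y walk) = step (X⊆Y x∈X) x~y (walk-mono X⊆Y walk)

  walk-++ : ∀ {z} → WalkIn G X x y → WalkIn G X y z → WalkIn G X x z
  walk-++ (here _)            walk′ = walk′
  walk-++ (step x∈X x~y walk) walk′ = step x∈X x~y (walk-++ walk walk′)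

  walk-reverse : WalkIn G X x y → WalkIn G X y x
  walk-reverse (here x∈X)          = here x∈X
  walk-reverse (step x∈X x~y walk) =
    walk-++ (walk-reverse walk) (step (walk-source walk) (Adj-sym G x~y) (here x∈X))

  ConnectedTo : Subset (n G) → Fin (n G) → Set
  ConnectedTo R r = ∀ {a} → a ∈ R → WalkIn G R a r

  ConnectedTo⇒ConnectedIn : r ∈ R → ConnectedTo R r → ConnectedIn G R
  ConnectedTo⇒ConnectedIn {r = r} r∈R R↝r =
    (r , r∈R) , λ _ _ a∈R b∈R → walk-++ (R↝r a∈R) (walk-reverse (R↝r b∈R))

  ConnectedIn⇒ConnectedTo : r ∈ R → ConnectedIn G R → ConnectedTo R r
  ConnectedIn⇒ConnectedTo r∈R (_ , walk) a∈R = walk _ _ a∈R r∈R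

  ConnectedTo-∪⁅⁆ : ConnectedTo R r → x ∈ R → Adj G y x → ConnectedTo (R ∪ ⁅ y ⁆) r
  ConnectedTo-∪⁅⁆ {R = R} {y = y} R↝r x∈R y~x {a} a∈R∪y with x∈p∪q⁻ R ⁅ y ⁆ a∈R∪y
  ... | inj₁ a∈R = walk-mono (p⊆p∪q ⁅ y ⁆) (R↝r a∈R)
  ... | inj₂ a∈y with refl ← x∈⁅y⁆⇒x≡y y a∈y = step a∈R∪y y~x (walk-mono (p⊆p∪q ⁅ y ⁆) (R↝r x∈R))

  clique-ConnectedTo : ∀ {K} → IsCliqueIn G X K → R ⊆ K → r ∈ R → ConnectedTo R r
  clique-ConnectedTo {r = r} (_ , adjacent) R⊆K r∈R {a} a∈R with a ≟ r
  ... | yes refl = here a∈R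
  ... | no  a≢r  = step a∈R (adjacent a r (R⊆K a∈R) (R⊆K r∈R) a≢r) (here r∈R)

  ClosedIn : Subset (n G) → Subset (n G) → Set
  ClosedIn A R = ∀ {x y} → x ∈ R → y ∈ A → Adj G x y → y ∈ R

  ClosedIn-walk : ClosedIn A R → WalkIn G A x y → y ∈ R → x ∈ R
  ClosedIn-walk closed (here _)            y∈R = y∈R
  ClosedIn-walk closed (step x∈A x~y walk) z∈R =
    closed (ClosedIn-walk closed walk z∈R) x∈A (Adj-sym G x~y)

  component : R ⊆ A → ConnectedTo R r →
              ∃ λ C → R ⊆ C × C ⊆ A × ConnectedTo C r × ClosedIn A C
  component {R = R} {A = A} {r = r} = grow (⊃-wellFounded R)
    where
    grow : ∀ {R} → Acc _⊃_ R → R ⊆ A → ConnectedTo R r →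
           ∃ λ C → R ⊆ C × C ⊆ A × ConnectedTo C r × ClosedIn A C
    grow {R} (acc larger) R⊆A R↝r
      with any? (λ x → any? λ y → x ∈? R ×-dec y ∈? A ×-dec ¬? (y ∈? R) ×-dec adj? G x y)
    ... | yes (x , y , x∈R , y∈A , y∉R , x~y)
      with C , R∪y⊆C , C-props ← grow (larger (p⊂p∪⁅x⁆ y∉R)) (p∪⁅x⁆⊆q R⊆A y∈A)
                                      (ConnectedTo-∪⁅⁆ R↝r x∈R (Adj-sym G x~y))
      = C , ⊆-trans (p⊆p∪q ⁅ y ⁆) R∪y⊆C , C-props
    ... | no no-exit = R , id , R⊆A , R↝r ,
      λ {x} {y} x∈R y∈A x~y →
        decidable-stable (y ∈? R) λ y∉R → no-exit (x , y , x∈R , y∈A , y∉R , x~y)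

  walk-exit : WalkIn G S w r → w ∉ R → r ∈ R → ∃₂ λ x y → x ∈ S × x ∉ R × y ∈ R × Adj G x y
  walk-exit (here _)   w∉R w∈R = contradiction w∈R w∉R
  walk-exit {R = R} (step {x} {y} x∈S x~y walk) x∉R r∈R with y ∈? R
  ... | yes y∈R = x , y , x∈S , x∉R , y∈R , x~y
  ... | no  y∉R = walk-exit walk y∉R r∈R

  non-cut-vertex-outside : ConnectedTo S r → R ⊆ S → r ∈ R → ConnectedTo R r → w ∈ S → w ∉ R →
                           ∃ λ z → z ∈ S × z ∉ R × ConnectedTo (S - z) r
  non-cut-vertex-outside {S = S} {r = r} {R = R} S↝r = go (⊃-wellFounded R)
    where
    -- Grow R by the exit vertex x of a walk from w; once S - x ⊆ R, x is not a cut vertex.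
    go : ∀ {R w} → Acc _⊃_ R → R ⊆ S → r ∈ R → ConnectedTo R r → w ∈ S → w ∉ R →
         ∃ λ z → z ∈ S × z ∉ R × ConnectedTo (S - z) r
    go {R} (acc larger) R⊆S r∈R R↝r w∈S w∉R
      with x , y , x∈S , x∉R , y∈R , x~y ← walk-exit (S↝r w∈S) w∉R r∈R
      with any? (λ u → u ∈? S - x ×-dec ¬? (u ∈? R))
    ... | yes (u , u∈S-x , u∉R)
      with z , z∈S , z∉R∪x , S-z↝r ←
             go (larger (p⊂p∪⁅x⁆ x∉R)) (p∪⁅x⁆⊆q R⊆S x∈S) (p⊆p∪q ⁅ x ⁆ r∈R)
                (ConnectedTo-∪⁅⁆ R↝r y∈R x~y) (p-x⊆p S x u∈S-x)
                ([ u∉R , x∈p-y⇒x≢y u∈S-x ∘ x∈⁅y⁆⇒x≡y x ]′ ∘ x∈p∪q⁻ R ⁅ x ⁆)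
      = z , z∈S , z∉R∪x ∘ p⊆p∪q ⁅ x ⁆ , S-z↝r
    ... | no S-x⊈R = x , x∈S , x∉R , λ {a} a∈S-x →
      walk-mono R⊆S-x (R↝r (decidable-stable (a ∈? R) λ a∉R → S-x⊈R (a , a∈S-x , a∉R)))
      where
      R⊆S-x : R ⊆ S - x
      R⊆S-x a∈R = x∈p∧x≢y⇒x∈p-y (R⊆S a∈R) λ { refl → x∉R a∈R }

  first-hit : ∀ {K} → WalkIn G S x y → y ∈ K →
              ∃ λ e → e ∈ K × ∀ {k} → k ∈ K → e ≢ k → WalkIn G (S - k) x e
  first-hit {x = x} {K = K} walk y∈K with x ∈? K
  ... | yes x∈K = x , x∈K , λ _ x≢k → here (x∈p∧x≢y⇒x∈p-y (walk-source walk) x≢k)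
  first-hit (here _) y∈K | no x∉K = contradiction y∈K x∉K
  first-hit (step x∈S x~y walk) z∈K | no x∉K
    with e , e∈K , avoiding ← first-hit walk z∈K
    = e , e∈K , λ k∈K e≢k → step (x∈p∧x≢y⇒x∈p-y x∈S λ { refl → x∉K k∈K }) x~y (avoiding k∈K e≢k)

  private variable
    K : Subset (n G)

  non-separating-clique-vertex :
    ∀ {p : Subset m} → ConnectedIn G S → K ⊆ S → ∣ p ∣ < ∣ K ∣ →
    (t : ∀ {u} → u ∈ p → Fin (n G)) → (∀ {u} (u∈p : u ∈ p) → t u∈p ∈ S) →
    ∃ λ k → k ∈ K × ∀ {u} (u∈p : u ∈ p) → ∃ λ e → e ∈ K - k × WalkIn G (S - k) (t u∈p) e
  non-separating-clique-vertex {S = S} {K = K} {p = p} S-connected K⊆S ∣p∣<∣K∣ t t∈S =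
    let k₀ , k₀∈K = 0<∣p∣⇒Nonempty (≤-<-trans z≤n ∣p∣<∣K∣)
        hit : ∀ {u} (u∈p : u ∈ p) →
              ∃ λ e → e ∈ K × ∀ {k} → k ∈ K → e ≢ k → WalkIn G (S - k) (t u∈p) e
        hit u∈p = first-hit (ConnectedIn⇒ConnectedTo (K⊆S k₀∈K) S-connected (t∈S u∈p)) k₀∈K
        k , k∈K , missed = ∣p∣<∣q∣⇒∃-missed ∣p∣<∣K∣ (proj₁ ∘ hit)
    in k , k∈K , λ u∈p → let e , e∈K , avoiding = hit u∈p
                        in e , x∈p∧x≢y⇒x∈p-y e∈K (missed u∈p) , avoiding k∈K (missed u∈p)

  non-cut-vertex-avoiding-terminals :
    ∀ {p : Subset m} → ConnectedIn G S → IsCliqueIn G S K → 1 < ∣ K ∣ → ∣ p ∣ < ∣ K ∣ →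
    (t : ∀ {u} → u ∈ p → Fin (n G)) → (∀ {u} (u∈p : u ∈ p) → t u∈p ∈ S) →
    ∃ λ z → z ∈ S × ConnectedIn G (S - z) × ∀ {u} (u∈p : u ∈ p) → t u∈p ≢ z
  non-cut-vertex-avoiding-terminals {S = S} {K = K} {p = p}
                                    S-connected K-clique@(K⊆S , _) 1<∣K∣ ∣p∣<∣K∣ t t∈S =
    let k , k∈K , reach = non-separating-clique-vertex S-connected K⊆S ∣p∣<∣K∣ t t∈S
        r , r∈K-k = 0<∣p∣⇒Nonempty (s≤s⁻¹ (<-≤-trans 1<∣K∣ (∣p∣≤suc∣p-x∣ K k)))
        K-k⊆S-k : K - k ⊆ S - k
        K-k⊆S-k a∈K-k = x∈p∧x≢y⇒x∈p-y (K⊆S (p-x⊆p K k a∈K-k)) (x∈p-y⇒x≢y a∈K-k)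
        C , K-k⊆C , C⊆S-k , C↝r , C-closed =
          component K-k⊆S-k (clique-ConnectedTo K-clique (p-x⊆p K k) r∈K-k)
        C⊆S : C ⊆ S
        C⊆S = p-x⊆p S k ∘ C⊆S-k
        r∈C = K-k⊆C r∈K-k
        r∈S-z : ∀ {z} → z ∉ C → r ∈ S - z
        r∈S-z z∉C = x∈p∧x≢y⇒x∈p-y (C⊆S r∈C) λ r≡z → z∉C (subst (_∈ C) r≡z r∈C)
        t∈C : ∀ {u} (u∈p : u ∈ p) → t u∈p ∈ C
        t∈C u∈p = let _ , e∈K-k , walk = reach u∈p in ClosedIn-walk C-closed walk (K-k⊆C e∈K-k)
        z , z∈S , z∉C , S-z↝r =
          non-cut-vertex-outside (ConnectedIn⇒ConnectedTo (C⊆S r∈C) S-connected) C⊆S r∈C C↝r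
                                 (K⊆S k∈K) (λ k∈C → x∈p-y⇒x≢y (C⊆S-k k∈C) refl)
    in z , z∈S , ConnectedTo⇒ConnectedIn (r∈S-z z∉C) S-z↝r ,
       λ u∈p t≡z → z∉C (subst (_∈ C) t≡z (t∈C u∈p))

module _ (G : Graph) {v u : Fin (n G)} where

  Adj⇒∈nbhd : Adj G v u → u ∈ nbhd G v
  Adj⇒∈nbhd v~u = lookup⇒[]= u _ (trans (lookup∘tabulate _ u) (dec-true (adj? G v u) v~u))

  ∈nbhd⇒Adj : u ∈ nbhd G v → Adj G v u
  ∈nbhd⇒Adj u∈N with adj? G v u | trans (sym (lookup∘tabulate _ u)) ([]=⇒lookup u∈N)
  ... | yes v~u | _ = v~u
  ... | no  _   | ()

module _ {H G : Graph} {X : Fin (n H) → Subset (n G)} {v : Fin (n H)} {z : Fin (n G)} where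

  ∈deleteFrom⁻ : ∀ {w x} → x ∈ deleteFrom X v z w → x ∈ X w
  ∈deleteFrom⁻ {w} x∈ with w ≟ v
  ... | yes _ = p-x⊆p (X w) z x∈
  ... | no  _ = x∈

  deleteFrom-connected : ∀ {w} → (∀ w → ConnectedIn G (X w)) → ConnectedIn G (X v - z) →
                         ConnectedIn G (deleteFrom X v z w)
  deleteFrom-connected {w} connected Xv-z-connected with w ≟ v
  ... | yes refl = Xv-z-connected
  ... | no  _    = connected w

  deleteFrom-isMinorModel :
    IsMinorModel H G X → ConnectedIn G (X v - z) →
    (∀ u → Adj H v u → ∃₂ λ t y → t ∈ X v - z × y ∈ X u × Adj G t y) →
    IsMinorModel H G (deleteFrom X v z)
  deleteFrom-isMinorModel model Xv-z-connected attached = record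
    { disjoint  = λ u w u≢w x x∈u x∈w → disjoint u w u≢w x (∈deleteFrom⁻ x∈u) (∈deleteFrom⁻ x∈w)
    ; connected = λ w → deleteFrom-connected {w} connected Xv-z-connected
    ; edges     = edges′
    }
    where
    open IsMinorModel model
    edges′ : ∀ u w → Adj H u w →
             ∃₂ λ x y → x ∈ deleteFrom X v z u × y ∈ deleteFrom X v z w × Adj G x y
    edges′ u w u~w with u ≟ v | w ≟ v
    ... | yes refl | yes refl = contradiction u~w (irrefl H)
    ... | yes refl | no _     = attached w u~w
    ... | no _     | yes refl with t , y , t∈ , y∈ , t~y ← attached u (Adj-sym H u~w)
      = y , t , y∈ , t∈ , Adj-sym G t~y
    ... | no _     | no _     = edges u w u~w

minimal-model-clique≤degree : ∀ {H G X v K} → IsMinimalMinorModel H G X →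
                              IsCliqueIn G (X v) K → 1 < ∣ K ∣ → ∣ K ∣ ≤ degree H v
minimal-model-clique≤degree {H} {G} {X} {v} {K} (model , minimal) K-clique 1<∣K∣ =
  decidable-stable (∣ K ∣ ≤? degree H v) λ ∣K∣≰deg →
  let z , z∈Xv , Xv-z-connected , terminal≢z =
        non-cut-vertex-avoiding-terminals G (connected v) K-clique 1<∣K∣ (≰⇒> ∣K∣≰deg)
          (proj₁ ∘ attachment) (proj₁ ∘ proj₂ ∘ proj₂ ∘ attachment)
      attached : ∀ u → Adj H v u → ∃₂ λ t y → t ∈ X v - z × y ∈ X u × Adj G t y
      attached u v~u =
        let t , y , t∈Xv , y∈Xu , t~y = attachment (Adj⇒∈nbhd H v~u)
        in t , y , x∈p∧x≢y⇒x∈p-y t∈Xv (terminal≢z (Adj⇒∈nbhd H v~u)) , y∈Xu , t~y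
  in minimal v z z∈Xv (deleteFrom-isMinorModel model Xv-z-connected attached)
  where
  open IsMinorModel model
  attachment : ∀ {u} → u ∈ nbhd H v → ∃₂ λ t y → t ∈ X v × y ∈ X u × Adj G t y
  attachment u∈N = edges v _ (∈nbhd⇒Adj H u∈N)

mainTheorem3 : (H G : Graph) → Subcubic H →
    (X : Fin (n H) → Subset (n G)) → IsMinimalMinorModel H G X →
    ∀ v → CliqueNumberAtMost G (X v) 3
mainTheorem3 H G subcubic X minimal-model v K K-clique with ∣ K ∣ ≤? 1
... | yes ∣K∣≤1 = ≤-trans ∣K∣≤1 (s≤s z≤n)
... | no ∣K∣≰1  =
  ≤-trans (minimal-model-clique≤degree minimal-model K-clique (≰⇒> ∣K∣≰1)) (subcubic v)
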